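{- Let $G$ be a graph in $\varepsilon_0$. Then for every pair of adjacent vertices $u,v$ of $G$, the maximum number of pairwise edge-disjoint $u$–$v$ paths in $G$ is exactly $2$.
   Context: All graphs are finite, simple, undirected and connected. An Euler graph is a connected graph in which every vertex has even degree. $\varepsilon_0$ denotes the class of Euler graphs $G$ such that every cycle of $G$ has length $n\equiv 0 \pmod 4$. -}

module Defs where

open import Data.Nat using (ℕ; zero; suc; _+_; _*_; _≥_; _≤_)
open import Data.Nat.Divisibility using (_∣_)
open import Data.Fin using (Fin)
open import Data.Bool using (Bool; true; false; T)
open import Data.List using (List; []; _∷_; length; filter)
open import Data.List.Base using (head; last)
open import Data.List.Membership.Propositional using (_∈_)
open import Data.List.Relation.Unary.Unique.Propositional using (Unique)
open import Data.Maybe using (Maybe; just)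
open import Data.Product using (_×_; _,_; ∃-syntax)
open import Data.Sum using (_⊎_)
open import Data.Unit using (⊤)
open import Relation.Nullary using (¬_)
open import Relation.Binary.PropositionalEquality using (_≡_)
open import Data.List using (allFin)
open import Data.Bool using (if_then_else_)

record Graph (n : ℕ) : Set where
  field
    adj    : Fin n → Fin n → Bool
    sym    : ∀ u v → adj u v ≡ adj v u
    irrefl : ∀ v → adj v v ≡ false

module _ {n : ℕ} (G : Graph n) where
  open Graph G

  Adj : Fin n → Fin n → Set
  Adj u v = T (adj u v)

  steps : List (Fin n) → List (Fin n × Fin n)
  steps []            = []
  steps (x ∷ [])      = []
  steps (x ∷ y ∷ xs)  = (x , y) ∷ steps (y ∷ xs)

  IsWalk : List (Fin n) → Set
  IsWalk xs = ∀ a b → (a , b) ∈ steps xs → Adj a b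

  record Path (u v : Fin n) : Set where
    field
      verts  : List (Fin n)
      start  : head verts ≡ just u
      end    : last verts ≡ just v
      walk   : IsWalk verts
      unique : Unique verts

  UsesEdge : List (Fin n) → Fin n → Fin n → Set
  UsesEdge xs a b = (a , b) ∈ steps xs ⊎ (b , a) ∈ steps xs

  EdgeDisjoint : {u v : Fin n} → Path u v → Path u v → Set
  EdgeDisjoint p q =
    ∀ a b → UsesEdge (Path.verts p) a b → ¬ UsesEdge (Path.verts q) a b

  PairwiseEdgeDisjoint : {u v : Fin n} {k : ℕ} → (Fin k → Path u v) → Set
  PairwiseEdgeDisjoint {k = k} P = ∀ (i j : Fin k) → ¬ i ≡ j → EdgeDisjoint (P i) (P j)

  MaxEdgeDisjointPaths : Fin n → Fin n → ℕ → Set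
  MaxEdgeDisjointPaths u v m =
    (∃[ P ] PairwiseEdgeDisjoint {u} {v} {m} P)
    × (∀ (k : ℕ) (P : Fin k → Path u v) → PairwiseEdgeDisjoint P → k ≤ m)

  Connected : Set
  Connected = ∀ (u v : Fin n) → Path u v

  degree : Fin n → ℕ
  degree v = length (filter (λ w → T? (adj v w)) (allFin n))
    where
      open import Data.Bool.Properties using (T?)

  Even : ℕ → Set
  Even d = 2 ∣ d

  IsEuler : Set
  IsEuler = 1 ≤ n × Connected × (∀ v → Even (degree v))

  -- a cycle v0 v1 ... v(k-1) v0: k ≥ 3 distinct vertices, consecutive ones
  -- adjacent and the last adjacent to the first; its length is k
  record Cycle : Set where
    field
      verts  : List (Fin n)
      long   : length verts ≥ 3
      walk   : IsWalk verts
      unique : Unique verts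
      close  : ∀ a b → head verts ≡ just a → last verts ≡ just b → Adj b a

  InEps0 : Set
  InEps0 = IsEuler × (∀ (C : Cycle) → 4 ∣ length (Cycle.verts C))

-- Lower bound: the edge uv itself, and a u–v path avoiding uv.  Such a path exists because a graph
-- with all degrees even has no bridge: if u were not reachable from v in G − uv, the vertex set S of
-- the component of v would have exactly one edge (vu) leaving it, whereas ∑_{a∈S} deg a = 2·e(S) + |∂S|
-- forces |∂S| to be even.
--
-- Upper bound: a closed trail splits at a repeated vertex into two shorter closed trails, so in a
-- graph whose cycles all have length ≡ 0 (mod 4) every closed trail does too.  Of three pairwise
-- edge-disjoint u–v paths at most one uses the edge uv; the other two, p and q, give the closed
-- trails p + vu, q + vu and p + q⁻¹ of lengths ℓp + 1, ℓq + 1 and ℓp + ℓq, whence 4 ∣ 2.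

module Submission where

open import Defs
open import Data.Nat using (ℕ; zero; suc; _+_; _*_; _≤_; _<_; z≤n; s≤s; z<s; _≤?_)
open import Data.Nat.Properties
  using (+-*-semiring; +-assoc; +-comm; +-identityʳ; *-identityʳ; *-zeroʳ; *-comm; ≰⇒>; m<m+n; m≤n+m;
         ≤-trans; n≤1+n)
open import Data.Nat.Tactic.RingSolver using (solve-∀)
open import Data.Nat.Divisibility using (_∣_; divides; ∣m∣n⇒∣m+n; ∣m+n∣m⇒∣n; ∣n⇒∣m*n; ∣⇒≤)
open import Data.Nat.Induction using (<-wellFounded)
open import Induction.WellFounded using (Acc; acc)
open import Data.Fin using (Fin; zero; suc; toℕ)
open import Data.Fin.Properties using (_≟_; pigeonhole)
open import Data.Bool using (Bool; true; false; T; _∧_; _∨_; not)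
open import Data.Bool.ListAction using (any)
open import Data.Bool.Properties using (T?; T-∧; T-∨; T-≡)
open import Data.List using (List; []; _∷_; _++_; [_]; length; filter; tabulate; allFin; reverse; _ʳ++_; lookup)
open import Data.List.Base using (head; last)
open import Data.List.Properties
  using (++-assoc; length-++; length-reverse; reverse-++; reverse-involutive; ʳ++-defn)
open import Data.List.Membership.Propositional using (_∈_; lose)
open import Data.List.Membership.Propositional.Properties
  using (∈-∃++; ∈-lookup; ∈-++⁻; ∈-++⁺ˡ; ∈-++⁺ʳ; ∈-allFin)
open import Data.List.Relation.Unary.All as All using (All; []; _∷_)
import Data.List.Relation.Unary.All.Properties as All
open import Data.List.Relation.Unary.Any using (here; there; any?; satisfied)
open import Data.List.Relation.Unary.Any.Properties using (any⁺; any⁻)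
open import Data.List.Relation.Unary.AllPairs using (AllPairs; []; _∷_)
import Data.List.Relation.Unary.AllPairs.Properties as AllPairs
open import Data.List.Relation.Unary.Unique.Propositional using (Unique)
open import Data.List.Relation.Binary.Permutation.Propositional using (↭⇒↭ₛ′; ↭-sym)
open import Data.List.Relation.Binary.Permutation.Propositional.Properties using (↭-reverse)
import Data.List.Relation.Binary.Permutation.Setoid.Properties as PermutationSetoid
open import Data.Maybe using (just)
open import Data.Product using (_×_; _,_; proj₁; proj₂; ∃-syntax; Σ-syntax)
open import Data.Product.Properties using (≡-dec)
open import Data.Sum using (_⊎_; inj₁; inj₂; swap)
open import Data.Empty using (⊥; ⊥-elim)
open import Data.Unit using (tt)
open import Function.Bundles using (module Equivalence; mk⇔)
open Equivalence using (to; from)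
open import Relation.Nullary using (¬_; Dec; yes; no; does)
open import Relation.Nullary.Decidable using (_⊎-dec_; _×-dec_; dec-true; does-⇔)
open import Relation.Binary.Definitions using (DecidableEquality)
open import Relation.Binary.PropositionalEquality
  using (_≡_; _≢_; refl; sym; trans; cong; cong₂; subst; setoid; isEquivalence; module ≡-Reasoning)
open import Algebra.Properties.Semiring.Sum +-*-semiring
  using (sum-syntax; ∑-distrib-+; *-distribˡ-sum; sum-cong-≗; sum-replicate-zero)

⟦_⟧ : Bool → ℕ
⟦ true ⟧  = 1
⟦ false ⟧ = 0

split-by : ∀ x s → x ≡ x * ⟦ s ⟧ + x * ⟦ not s ⟧
split-by x true  = sym (trans (cong₂ _+_ (*-identityʳ x) (*-zeroʳ x)) (+-identityʳ x))
split-by x false = sym (cong₂ _+_ (*-zeroʳ x) (*-identityʳ x))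

+-suc-swap : ∀ a b c → a + suc (b + c) ≡ b + suc (a + c)
+-suc-swap = solve-∀

+-pair-swap : ∀ a b → (a + 1) + (b + 1) ≡ (a + b) + 2
+-pair-swap = solve-∀

*-reverse : ∀ a b c → a * b * c ≡ c * b * a
*-reverse = solve-∀

∑-zero : ∀ {n} (f : Fin n → ℕ) → (∀ i → f i ≡ 0) → ∑[ i < n ] f i ≡ 0
∑-zero {n} f f≡0 = trans (sum-cong-≗ f≡0) (sum-replicate-zero n)

∑-supported : ∀ {n} (f : Fin n → ℕ) (i : Fin n) → (∀ j → j ≢ i → f j ≡ 0) → ∑[ j < n ] f j ≡ f i
∑-supported f zero    f≡0 =
  trans (cong (f zero +_) (∑-zero _ λ j → f≡0 (suc j) λ ())) (+-identityʳ (f zero))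
∑-supported f (suc i) f≡0 =
  cong₂ _+_ (f≡0 zero λ ()) (∑-supported _ i λ j j≢i → f≡0 (suc j) λ { refl → j≢i refl })

∑-even : ∀ {n} (f : Fin n → ℕ) → (∀ i → 2 ∣ f i) → 2 ∣ ∑[ i < n ] f i
∑-even {zero}  f even = divides 0 refl
∑-even {suc n} f even = ∣m∣n⇒∣m+n (even zero) (∑-even (λ i → f (suc i)) (λ i → even (suc i)))

∑∑-symmetric-even : ∀ {n} (f : Fin n → Fin n → ℕ) → (∀ i j → f i j ≡ f j i) → (∀ i → f i i ≡ 0) →
                    2 ∣ ∑[ i < n ] ∑[ j < n ] f i j
∑∑-symmetric-even {zero}  f f-sym f-diag = divides 0 refl
∑∑-symmetric-even {suc n} f f-sym f-diag =
  subst (2 ∣_) (sym total) (∣m∣n⇒∣m+n (divides X X+X≡X*2) inner-even)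
  where
  X = ∑[ j < n ] f zero (suc j)
  inner = ∑[ i < n ] ∑[ j < n ] f (suc i) (suc j)
  X+X≡X*2 : X + X ≡ X * 2
  X+X≡X*2 = trans (cong (X +_) (sym (+-identityʳ X))) (*-comm 2 X)
  inner-even : 2 ∣ inner
  inner-even = ∑∑-symmetric-even (λ i j → f (suc i) (suc j)) (λ i j → f-sym (suc i) (suc j)) (λ i → f-diag (suc i))
  open ≡-Reasoning
  total : ∑[ i < suc n ] ∑[ j < suc n ] f i j ≡ (X + X) + inner
  total = begin
    (f zero zero + X) + ∑[ i < n ] (f (suc i) zero + ∑[ j < n ] f (suc i) (suc j))
      ≡⟨ cong₂ _+_ (cong (_+ X) (f-diag zero)) (∑-distrib-+ (λ i → f (suc i) zero) _) ⟩
    X + (∑[ i < n ] f (suc i) zero + inner)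
      ≡⟨ cong (λ Y → X + (Y + inner)) (sum-cong-≗ λ i → f-sym (suc i) zero) ⟩
    X + (X + inner)
      ≡⟨ +-assoc X X inner ⟨
    (X + X) + inner ∎

length-filter-tabulate : ∀ {A : Set} {m} (p : A → Bool) (f : Fin m → A) →
                         length (filter (λ x → T? (p x)) (tabulate f)) ≡ ∑[ i < m ] ⟦ p (f i) ⟧
length-filter-tabulate {m = zero}  p f = refl
length-filter-tabulate {m = suc m} p f with p (f zero)
... | true  = cong suc (length-filter-tabulate p (λ i → f (suc i)))
... | false = length-filter-tabulate p (λ i → f (suc i))

module _ {A : Set} where

  AllPairs-++⁻ : ∀ {R : A → A → Set} xs {ys} → AllPairs R (xs ++ ys) →
                 AllPairs R xs × AllPairs R ys × All (λ x → All (R x) ys) xs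
  AllPairs-++⁻ []       rs        = [] , rs , []
  AllPairs-++⁻ (x ∷ xs) (rx ∷ rs) with AllPairs-++⁻ xs rs
  ... | rxs , rys , rxs-ys = All.++⁻ˡ xs rx ∷ rxs , rys , All.++⁻ʳ xs rx ∷ rxs-ys

  AllPairs-middle : ∀ {R : A → A → Set} xs ys {zs} → AllPairs R (xs ++ ys ++ zs) →
                    AllPairs R ys × AllPairs R (xs ++ zs)
  AllPairs-middle xs ys rs with AllPairs-++⁻ xs rs
  ... | rxs , ryszs , rxs-yszs with AllPairs-++⁻ ys ryszs
  ...   | rys , rzs , _ = rys , AllPairs.++⁺ rxs rzs (All.map (All.++⁻ʳ ys) rxs-yszs)

  Unique-reverse : ∀ {xs : List A} → Unique xs → Unique (reverse xs)
  Unique-reverse {xs} =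
    PermutationSetoid.Unique-resp-↭ (setoid A) (↭⇒↭ₛ′ isEquivalence (↭-sym (↭-reverse xs)))

  last-++ : ∀ xs (y : A) ys → last (xs ++ y ∷ ys) ≡ last (y ∷ ys)
  last-++ []            y ys = refl
  last-++ (x ∷ [])      y ys = refl
  last-++ (x ∷ x′ ∷ xs) y ys = last-++ (x′ ∷ xs) y ys

  last⇒snoc : ∀ xs {y : A} → last xs ≡ just y → ∃[ ys ] xs ≡ ys ++ [ y ]
  last⇒snoc (x ∷ [])      refl = [] , refl
  last⇒snoc (x ∷ x′ ∷ xs) eq with last⇒snoc (x′ ∷ xs) eq
  ... | ys , xs≡ = x ∷ ys , cong (x ∷_) xs≡

  reverse-∷-snoc : ∀ (u : A) m v → reverse (u ∷ m ++ [ v ]) ≡ v ∷ reverse m ++ [ u ]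
  reverse-∷-snoc u m v = begin
    reverse (u ∷ m ++ [ v ])       ≡⟨ ʳ++-defn (m ++ [ v ]) ⟩
    reverse (m ++ [ v ]) ++ [ u ]  ≡⟨ cong (_++ [ u ]) (reverse-++ m [ v ]) ⟩
    v ∷ reverse m ++ [ u ]         ∎
    where open ≡-Reasoning

  ++-snoc-assoc : ∀ as (y : A) bs cs x → (as ++ y ∷ bs ++ y ∷ cs) ++ [ x ] ≡ as ++ y ∷ bs ++ y ∷ cs ++ [ x ]
  ++-snoc-assoc as y bs cs x =
    trans (++-assoc as (y ∷ bs ++ y ∷ cs) [ x ]) (cong (λ l → as ++ y ∷ l) (++-assoc bs (y ∷ cs) [ x ]))

  Repeats : List A → Set
  Repeats xs = ∃[ as ] ∃[ y ] ∃[ bs ] ∃[ cs ] xs ≡ as ++ y ∷ bs ++ y ∷ cs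

  unique-or-repeats : DecidableEquality A → (xs : List A) → Unique xs ⊎ Repeats xs
  unique-or-repeats _≟ₐ_ [] = inj₁ []
  unique-or-repeats _≟ₐ_ (x ∷ xs) with any? (x ≟ₐ_) xs
  ... | yes x∈xs with ∈-∃++ x∈xs
  ...   | bs , cs , refl = inj₂ ([] , x , bs , cs , refl)
  unique-or-repeats _≟ₐ_ (x ∷ xs) | no x∉xs with unique-or-repeats _≟ₐ_ xs
  ... | inj₁ uniq                      = inj₁ (All.¬Any⇒All¬ xs x∉xs ∷ uniq)
  ... | inj₂ (as , y , bs , cs , refl) = inj₂ (x ∷ as , y , bs , cs , refl)

Unique⇒length≤ : ∀ {n} {xs : List (Fin n)} → Unique xs → length xs ≤ n
Unique⇒length≤ {n} {xs} uniq with length xs ≤? n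
... | yes ≤n = ≤n
... | no ≰n with pigeonhole (≰⇒> ≰n) (lookup xs)
...   | i , j , i<j , same = ⊥-elim (lookup-injective uniq i j i<j same)
  where
  lookup-injective : ∀ {ys : List (Fin n)} → Unique ys → ∀ i j → toℕ i < toℕ j → lookup ys i ≢ lookup ys j
  lookup-injective (y∉ys ∷ _) zero    (suc j) _         = All.lookup y∉ys (∈-lookup j)
  lookup-injective (_ ∷ uniq) (suc i) (suc j) (s≤s i<j) = lookup-injective uniq i j i<j

SameEdge : ∀ {n} → Fin n × Fin n → Fin n × Fin n → Set
SameEdge (a , b) (c , d) = (a ≡ c × b ≡ d) ⊎ (a ≡ d × b ≡ c)

SameEdge? : ∀ {n} (e f : Fin n × Fin n) → Dec (SameEdge e f)
SameEdge? (a , b) (c , d) = ((a ≟ c) ×-dec (b ≟ d)) ⊎-dec ((a ≟ d) ×-dec (b ≟ c))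

SameEdge-flip : ∀ {n} {a b : Fin n} {f} → SameEdge (a , b) f → SameEdge (b , a) f
SameEdge-flip (inj₁ (a≡c , b≡d)) = inj₂ (b≡d , a≡c)
SameEdge-flip (inj₂ (a≡d , b≡c)) = inj₁ (b≡c , a≡d)

DistinctEdges : ∀ {n} → List (Fin n × Fin n) → Set
DistinctEdges = AllPairs (λ e f → ¬ SameEdge e f)

module _ {n : ℕ} (G : Graph n) where

  open Graph G using (adj; irrefl)

  Adj-irrefl : ∀ {a} → ¬ Adj G a a
  Adj-irrefl {a} = subst T (irrefl a)

  Adj-sym : ∀ {a b} → Adj G a b → Adj G b a
  Adj-sym {a} {b} = subst T (Graph.sym G a b)

  Adj⇒≢ : ∀ {a b} → Adj G a b → a ≢ b
  Adj⇒≢ ab refl = Adj-irrefl ab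

  steps-++ : ∀ xs (y : Fin n) ys → steps G (xs ++ y ∷ ys) ≡ steps G (xs ++ [ y ]) ++ steps G (y ∷ ys)
  steps-++ []            y ys = refl
  steps-++ (x ∷ [])      y ys = refl
  steps-++ (x ∷ x′ ∷ xs) y ys = cong ((x , x′) ∷_) (steps-++ (x′ ∷ xs) y ys)

  length-steps : ∀ x xs → length (steps G (x ∷ xs)) ≡ length xs
  length-steps x []       = refl
  length-steps x (y ∷ xs) = cong suc (length-steps y xs)

  ∈-steps⁻ : ∀ xs {a b} → (a , b) ∈ steps G xs → a ∈ xs × b ∈ xs
  ∈-steps⁻ (x ∷ y ∷ xs) (here refl) = here refl , there (here refl)
  ∈-steps⁻ (x ∷ y ∷ xs) (there ab∈) with ∈-steps⁻ (y ∷ xs) ab∈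
  ... | a∈ , b∈ = there a∈ , there b∈

  ∈-steps-++⁺ˡ : ∀ xs ys {e} → e ∈ steps G xs → e ∈ steps G (xs ++ ys)
  ∈-steps-++⁺ˡ (x ∷ y ∷ xs) ys (here e≡)  = here e≡
  ∈-steps-++⁺ˡ (x ∷ y ∷ xs) ys (there e∈) = there (∈-steps-++⁺ˡ (y ∷ xs) ys e∈)

  ∈-steps-++⁺ʳ : ∀ xs (y : Fin n) ys {e} → e ∈ steps G (y ∷ ys) → e ∈ steps G (xs ++ y ∷ ys)
  ∈-steps-++⁺ʳ xs y ys e∈ = subst (_ ∈_) (sym (steps-++ xs y ys)) (∈-++⁺ʳ (steps G (xs ++ [ y ])) e∈)

  ∈-steps-snoc : ∀ xs {b} z → last xs ≡ just b → (b , z) ∈ steps G (xs ++ [ z ])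
  ∈-steps-snoc (x ∷ [])      z refl = here refl
  ∈-steps-snoc (x ∷ x′ ∷ xs) z eq   = there (∈-steps-snoc (x′ ∷ xs) z eq)

  ∈-steps⇒split : ∀ xs {a b} → (a , b) ∈ steps G xs → ∃[ ys ] ∃[ zs ] xs ≡ ys ++ a ∷ b ∷ zs
  ∈-steps⇒split (x ∷ y ∷ xs) (here refl) = [] , xs , refl
  ∈-steps⇒split (x ∷ y ∷ xs) (there ab∈) with ∈-steps⇒split (y ∷ xs) ab∈
  ... | ys , zs , xs≡ = x ∷ ys , zs , cong (x ∷_) xs≡

  split⇒∈-steps : ∀ ys (a b : Fin n) zs → (a , b) ∈ steps G (ys ++ a ∷ b ∷ zs)
  split⇒∈-steps []            a b zs = here refl
  split⇒∈-steps (y ∷ [])      a b zs = there (here refl)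
  split⇒∈-steps (y ∷ y′ ∷ ys) a b zs = there (split⇒∈-steps (y′ ∷ ys) a b zs)

  ∈-steps-reverse : ∀ xs {a b} → (a , b) ∈ steps G (reverse xs) → (b , a) ∈ steps G xs
  ∈-steps-reverse xs {a} {b} ab∈ with ∈-steps⇒split (reverse xs) ab∈
  ... | ys , zs , rev≡ = subst (λ l → (b , a) ∈ steps G l) xs≡ (split⇒∈-steps (reverse zs) b a (reverse ys))
    where
    open ≡-Reasoning
    xs≡ : reverse zs ++ b ∷ a ∷ reverse ys ≡ xs
    xs≡ = begin
      reverse zs ++ b ∷ a ∷ reverse ys    ≡⟨ ʳ++-defn zs ⟨
      (a ∷ b ∷ zs) ʳ++ reverse ys         ≡⟨ ʳ++-defn (a ∷ b ∷ zs) ⟩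
      reverse (a ∷ b ∷ zs) ++ reverse ys  ≡⟨ reverse-++ ys (a ∷ b ∷ zs) ⟨
      reverse (ys ++ a ∷ b ∷ zs)          ≡⟨ cong reverse rev≡ ⟨
      reverse (reverse xs)                ≡⟨ reverse-involutive xs ⟩
      xs                                  ∎

  IsWalk-⊆ : ∀ {xs ys} → (∀ {e} → e ∈ steps G ys → e ∈ steps G xs) → IsWalk G xs → IsWalk G ys
  IsWalk-⊆ ys⊆xs walk a b ab∈ = walk a b (ys⊆xs ab∈)

  IsWalk-reverse : ∀ {xs} → IsWalk G xs → IsWalk G (reverse xs)
  IsWalk-reverse {xs} walk a b ab∈ = Adj-sym (walk b a (∈-steps-reverse xs ab∈))

  -- Trails

  IsTrail : List (Fin n) → Set
  IsTrail xs = IsWalk G xs × DistinctEdges (steps G xs)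

  Unique⇒DistinctEdges : ∀ {xs} → Unique xs → DistinctEdges (steps G xs)
  Unique⇒DistinctEdges {[]}         _           = []
  Unique⇒DistinctEdges {x ∷ []}     _           = []
  Unique⇒DistinctEdges {x ∷ y ∷ xs} (x∉ ∷ uniq) = All.tabulate distinct ∷ Unique⇒DistinctEdges uniq
    where
    distinct : ∀ {e} → e ∈ steps G (y ∷ xs) → ¬ SameEdge (x , y) e
    distinct e∈ (inj₁ (refl , _)) = All.lookup x∉ (proj₁ (∈-steps⁻ (y ∷ xs) e∈)) refl
    distinct e∈ (inj₂ (refl , _)) = All.lookup x∉ (proj₂ (∈-steps⁻ (y ∷ xs) e∈)) refl

  IsTrail-++ : ∀ xs y ys → IsTrail (xs ++ [ y ]) → IsTrail (y ∷ ys) →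
               (∀ {e f} → e ∈ steps G (xs ++ [ y ]) → f ∈ steps G (y ∷ ys) → ¬ SameEdge e f) →
               IsTrail (xs ++ y ∷ ys)
  IsTrail-++ xs y ys (walk₁ , distinct₁) (walk₂ , distinct₂) cross =
    walk , subst DistinctEdges (sym (steps-++ xs y ys))
             (AllPairs.++⁺ distinct₁ distinct₂ (All.tabulate λ e∈ → All.tabulate (cross e∈)))
    where
    walk : IsWalk G (xs ++ y ∷ ys)
    walk a b ab∈ with ∈-++⁻ (steps G (xs ++ [ y ])) (subst ((a , b) ∈_) (steps-++ xs y ys) ab∈)
    ... | inj₁ ab∈₁ = walk₁ a b ab∈₁
    ... | inj₂ ab∈₂ = walk₂ a b ab∈₂

  IsTrail-split : ∀ xs y ys zs → IsTrail (xs ++ y ∷ ys ++ y ∷ zs) →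
                  IsTrail (y ∷ ys ++ [ y ]) × IsTrail (xs ++ y ∷ zs)
  IsTrail-split xs y ys zs (walk , distinct) =
    (IsWalk-⊆ (λ e∈ → ∈E (∈-++⁺ʳ E₁ (∈-++⁺ˡ e∈))) walk , proj₁ distinct-parts) ,
    (IsWalk-⊆ outer⊆ walk , subst DistinctEdges (sym (steps-++ xs y zs)) (proj₂ distinct-parts))
    where
    E₁ = steps G (xs ++ [ y ])
    E₂ = steps G (y ∷ ys ++ [ y ])
    E₃ = steps G (y ∷ zs)
    E≡ : steps G (xs ++ y ∷ ys ++ y ∷ zs) ≡ E₁ ++ E₂ ++ E₃
    E≡ = trans (steps-++ xs y (ys ++ y ∷ zs)) (cong (E₁ ++_) (steps-++ (y ∷ ys) y zs))
    distinct-parts : DistinctEdges E₂ × DistinctEdges (E₁ ++ E₃)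
    distinct-parts = AllPairs-middle E₁ E₂ (subst DistinctEdges E≡ distinct)
    ∈E : ∀ {e} → e ∈ E₁ ++ E₂ ++ E₃ → e ∈ steps G (xs ++ y ∷ ys ++ y ∷ zs)
    ∈E = subst (_ ∈_) (sym E≡)
    outer⊆ : ∀ {e} → e ∈ steps G (xs ++ y ∷ zs) → e ∈ steps G (xs ++ y ∷ ys ++ y ∷ zs)
    outer⊆ e∈ with ∈-++⁻ E₁ (subst (_ ∈_) (steps-++ xs y zs) e∈)
    ... | inj₁ e∈₁ = ∈E (∈-++⁺ˡ e∈₁)
    ... | inj₂ e∈₃ = ∈E (∈-++⁺ʳ E₁ (∈-++⁺ʳ E₂ e∈₃))

  closedTrail-split : ∀ {x m} → Repeats (x ∷ m) → IsTrail (x ∷ m ++ [ x ]) →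
                      ∃[ y ] ∃[ bs ] ∃[ m′ ] IsTrail (y ∷ bs ++ [ y ]) × IsTrail (x ∷ m′ ++ [ x ]) ×
                                             length m ≡ length bs + suc (length m′)
  closedTrail-split {x} ([] , .x , bs , cs , refl) trail
    with IsTrail-split [] x bs (cs ++ [ x ]) (subst IsTrail (++-snoc-assoc [] x bs cs x) trail)
  ... | loop , rest = x , bs , cs , loop , rest , length-++ bs
  closedTrail-split {x} (.x ∷ as , y , bs , cs , refl) trail
    with IsTrail-split (x ∷ as) y bs (cs ++ [ x ]) (subst IsTrail (++-snoc-assoc (x ∷ as) y bs cs x) trail)
  ... | loop , rest =
    y , bs , as ++ y ∷ cs , loop , subst IsTrail (cong (x ∷_) (sym (++-assoc as (y ∷ cs) [ x ]))) rest , len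
    where
    open ≡-Reasoning
    len : length (as ++ y ∷ bs ++ y ∷ cs) ≡ length bs + suc (length (as ++ y ∷ cs))
    len = begin
      length (as ++ y ∷ bs ++ y ∷ cs)                ≡⟨ length-++ as ⟩
      length as + suc (length (bs ++ y ∷ cs))        ≡⟨ cong (λ k → length as + suc k) (length-++ bs) ⟩
      length as + suc (length bs + suc (length cs))  ≡⟨ +-suc-swap (length as) (length bs) _ ⟩
      length bs + suc (length as + suc (length cs))  ≡⟨ cong (λ k → length bs + suc k) (length-++ as) ⟨
      length bs + suc (length (as ++ y ∷ cs))        ∎

  closedTrail⇒Cycle : ∀ {x m} → Unique (x ∷ m) → IsTrail (x ∷ m ++ [ x ]) →
                      Σ[ C ∈ Cycle G ] Cycle.verts C ≡ x ∷ m
  closedTrail⇒Cycle {x} {[]}          _    (walk , _)                = ⊥-elim (Adj-irrefl (walk x x (here refl)))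
  closedTrail⇒Cycle {x} {_ ∷ []}      _    (_ , (returns ∷ _) ∷ _)   = ⊥-elim (returns (inj₂ (refl , refl)))
  closedTrail⇒Cycle {x} {x₁ ∷ x₂ ∷ m} uniq (walk , _) = cycle , refl
    where
    cycle : Cycle G
    cycle = record
      { verts  = x ∷ x₁ ∷ x₂ ∷ m
      ; long   = s≤s (s≤s (s≤s z≤n))
      ; walk   = IsWalk-⊆ (∈-steps-++⁺ˡ (x ∷ x₁ ∷ x₂ ∷ m) [ x ]) walk
      ; unique = uniq
      ; close  = λ { a b refl last≡b → walk b a (∈-steps-snoc (x ∷ x₁ ∷ x₂ ∷ m) a last≡b) }
      }

  pathLength : ∀ {u v} → Path G u v → ℕ
  pathLength p = length (steps G (Path.verts p))

  trivialPath : ∀ t → Path G t t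
  trivialPath t = record { verts = t ∷ [] ; start = refl ; end = refl ; walk = λ _ _ () ; unique = [] ∷ [] }

  edgePath : ∀ {u v} → Adj G u v → Path G u v
  edgePath uv = record
    { verts = _ ∷ _ ∷ [] ; start = refl ; end = refl
    ; walk = λ { a b (here refl) → uv } ; unique = (Adj⇒≢ uv ∷ []) ∷ [] ∷ [] }

  Path-suffix : ∀ {a w t} (p : Path G a t) xs ys → Path.verts p ≡ xs ++ w ∷ ys → Path G w t
  Path-suffix {w = w} p xs ys p≡ = record
    { verts  = w ∷ ys
    ; start  = refl
    ; end    = trans (sym (last-++ xs w ys)) (trans (cong last (sym p≡)) (Path.end p))
    ; walk   = IsWalk-⊆ (λ e∈ → subst (λ l → _ ∈ steps G l) (sym p≡) (∈-steps-++⁺ʳ xs w ys e∈)) (Path.walk p)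
    ; unique = proj₁ (proj₂ (AllPairs-++⁻ xs (subst Unique p≡ (Path.unique p))))
    }

  Path-cons : ∀ {w x t} → Adj G w x → Path G x t → Path G w t
  Path-cons {w} wx p with any? (w ≟_) (Path.verts p)
  ... | yes w∈p with ∈-∃++ w∈p
  ...   | xs , ys , p≡ = Path-suffix p xs ys p≡
  Path-cons {w} wx record { verts = x ∷ rest ; start = refl ; end = end ; walk = walk ; unique = unique }
      | no w∉p = record
    { verts  = w ∷ x ∷ rest
    ; start  = refl
    ; end    = end
    ; walk   = λ { a b (here refl) → wx ; a b (there ab∈) → walk a b ab∈ }
    ; unique = All.¬Any⇒All¬ _ w∉p ∷ unique
    }

  Path-interior : ∀ {u v} → u ≢ v → (p : Path G u v) → ∃[ m ] Path.verts p ≡ u ∷ m ++ [ v ]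
  Path-interior u≢v p = interior (Path.verts p) (Path.start p) (Path.end p)
    where
    interior : ∀ xs → head xs ≡ just _ → last xs ≡ just _ → ∃[ m ] xs ≡ _ ∷ m ++ [ _ ]
    interior (x ∷ [])     refl refl = ⊥-elim (u≢v refl)
    interior (x ∷ y ∷ xs) refl end with last⇒snoc (y ∷ xs) end
    ... | m , xs≡ = m , cong (x ∷_) xs≡

  pathLength-interior : ∀ {u v m} (p : Path G u v) → Path.verts p ≡ u ∷ m ++ [ v ] → pathLength p ≡ suc (length m)
  pathLength-interior {u} {v} {m} p p≡ = begin
    pathLength p                       ≡⟨ cong (λ xs → length (steps G xs)) p≡ ⟩
    length (steps G (u ∷ m ++ [ v ]))  ≡⟨ length-steps u (m ++ [ v ]) ⟩
    length (m ++ [ v ])                ≡⟨ length-++ m ⟩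
    length m + 1                       ≡⟨ +-comm (length m) 1 ⟩
    suc (length m)                     ∎
    where open ≡-Reasoning

  Path⇒IsTrail : ∀ {u v} (p : Path G u v) → IsTrail (Path.verts p)
  Path⇒IsTrail p = Path.walk p , Unique⇒DistinctEdges (Path.unique p)

  reversePath⇒IsTrail : ∀ {u v} (p : Path G u v) → IsTrail (reverse (Path.verts p))
  reversePath⇒IsTrail p = IsWalk-reverse (Path.walk p) , Unique⇒DistinctEdges (Unique-reverse (Path.unique p))

  EdgeDisjoint-sym : ∀ {u v} (p q : Path G u v) → EdgeDisjoint G p q → EdgeDisjoint G q p
  EdgeDisjoint-sym p q disjoint a b usesQ usesP = disjoint a b usesP usesQ

  avoids⇒EdgeDisjoint-edgePath : ∀ {u v} (uv : Adj G u v) (p : Path G u v) →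
                                 ¬ UsesEdge G (Path.verts p) u v → EdgeDisjoint G p (edgePath uv)
  avoids⇒EdgeDisjoint-edgePath uv p avoids a b usesP (inj₁ (here refl)) = avoids usesP
  avoids⇒EdgeDisjoint-edgePath uv p avoids a b usesP (inj₂ (here refl)) = avoids (swap usesP)

  UsesEdge? : ∀ xs (a b : Fin n) → Dec (UsesEdge G xs a b)
  UsesEdge? xs a b = ((a , b) ∈? steps G xs) ⊎-dec ((b , a) ∈? steps G xs)
    where open import Data.List.Membership.DecPropositional (≡-dec _≟_ _≟_) using (_∈?_)

  disjointPaths⇒closedTrail : ∀ {u v m₁ m₂} (p q : Path G u v) → EdgeDisjoint G p q →
                              Path.verts p ≡ u ∷ m₁ ++ [ v ] → Path.verts q ≡ u ∷ m₂ ++ [ v ] →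
                              IsTrail (u ∷ (m₁ ++ v ∷ reverse m₂) ++ [ u ])
  disjointPaths⇒closedTrail {u} {v} {m₁} {m₂} p q disjoint p≡ q≡ =
    subst IsTrail (cong (u ∷_) (sym (++-assoc m₁ (v ∷ reverse m₂) [ u ])))
      (IsTrail-++ (u ∷ m₁) v (reverse m₂ ++ [ u ]) (subst IsTrail p≡ (Path⇒IsTrail p))
        (subst IsTrail q⁻¹≡ (reversePath⇒IsTrail q)) cross)
    where
    q⁻¹≡ : reverse (Path.verts q) ≡ v ∷ reverse m₂ ++ [ u ]
    q⁻¹≡ = trans (cong reverse q≡) (reverse-∷-snoc u m₂ v)
    cross : ∀ {e f} → e ∈ steps G (u ∷ m₁ ++ [ v ]) → f ∈ steps G (v ∷ reverse m₂ ++ [ u ]) → ¬ SameEdge e f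
    cross {f = a , b} e∈ f∈ same = disjoint a b (p-uses same) (inj₂ ba∈q)
      where
      ba∈q : (b , a) ∈ steps G (Path.verts q)
      ba∈q = ∈-steps-reverse (Path.verts q) (subst (λ l → (a , b) ∈ steps G l) (sym q⁻¹≡) f∈)
      e∈p : _ ∈ steps G (Path.verts p)
      e∈p = subst (λ l → _ ∈ steps G l) (sym p≡) e∈
      p-uses : SameEdge _ (a , b) → UsesEdge G (Path.verts p) a b
      p-uses (inj₁ (refl , refl)) = inj₁ e∈p
      p-uses (inj₂ (refl , refl)) = inj₂ e∈p

  module _ {d : ℕ} (cycle-length : ∀ (C : Cycle G) → d ∣ length (Cycle.verts C)) where

    closedTrail-length : ∀ x m → IsTrail (x ∷ m ++ [ x ]) → d ∣ suc (length m)
    closedTrail-length x m = go x m (<-wellFounded (length m))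
      where
      go : ∀ x m → Acc _<_ (length m) → IsTrail (x ∷ m ++ [ x ]) → d ∣ suc (length m)
      go x m (acc shorter) trail with unique-or-repeats _≟_ (x ∷ m)
      ... | inj₁ uniq with closedTrail⇒Cycle uniq trail
      ...   | C , refl = cycle-length C
      go x m (acc shorter) trail | inj₂ repeats with closedTrail-split repeats trail
      ... | y , bs , m′ , loop , rest , len rewrite len =
        ∣m∣n⇒∣m+n (go y bs (shorter (m<m+n (length bs) z<s)) loop) (go x m′ (shorter (m≤n+m _ _)) rest)

    disjointPaths-length : ∀ {u v} → u ≢ v → (p q : Path G u v) → EdgeDisjoint G p q →
                           d ∣ pathLength p + pathLength q
    disjointPaths-length {u} {v} u≢v p q disjoint with Path-interior u≢v p | Path-interior u≢v q
    ... | m₁ , p≡ | m₂ , q≡ =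
      subst (d ∣_) length≡ (closedTrail-length u _ (disjointPaths⇒closedTrail p q disjoint p≡ q≡))
      where
      open ≡-Reasoning
      length≡ : suc (length (m₁ ++ v ∷ reverse m₂)) ≡ pathLength p + pathLength q
      length≡ = begin
        suc (length (m₁ ++ v ∷ reverse m₂))          ≡⟨ cong suc (length-++ m₁) ⟩
        suc (length m₁) + suc (length (reverse m₂))
          ≡⟨ cong (λ k → suc (length m₁) + suc k) (length-reverse m₂) ⟩
        suc (length m₁) + suc (length m₂)
          ≡⟨ cong₂ _+_ (pathLength-interior p p≡) (pathLength-interior q q≡) ⟨
        pathLength p + pathLength q ∎

  module _ (cycle-length : ∀ (C : Cycle G) → 4 ∣ length (Cycle.verts C)) {u v : Fin n} (uv : Adj G u v) where

    no-disjoint-paths-avoiding-edge : (p q : Path G u v) → EdgeDisjoint G p q →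
                                      ¬ UsesEdge G (Path.verts p) u v → ¬ UsesEdge G (Path.verts q) u v → ⊥
    no-disjoint-paths-avoiding-edge p q disjoint p-avoids q-avoids = 4≰2 (∣⇒≤ 4∣2)
      where
      ∣length : ∀ (p q : Path G u v) → EdgeDisjoint G p q → 4 ∣ pathLength p + pathLength q
      ∣length = disjointPaths-length cycle-length (Adj⇒≢ uv)
      4∣ℓp+ℓq+2 : 4 ∣ (pathLength p + pathLength q) + 2
      4∣ℓp+ℓq+2 = subst (4 ∣_) (+-pair-swap (pathLength p) (pathLength q))
        (∣m∣n⇒∣m+n (∣length p (edgePath uv) (avoids⇒EdgeDisjoint-edgePath uv p p-avoids))
                   (∣length q (edgePath uv) (avoids⇒EdgeDisjoint-edgePath uv q q-avoids)))
      4∣2 : 4 ∣ 2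
      4∣2 = ∣m+n∣m⇒∣n 4∣ℓp+ℓq+2 (∣length p q disjoint)
      4≰2 : ¬ 4 ≤ 2
      4≰2 (s≤s (s≤s ()))

    no-three-disjoint-paths : (p q r : Path G u v) →
                              EdgeDisjoint G p q → EdgeDisjoint G p r → EdgeDisjoint G q r → ⊥
    no-three-disjoint-paths p q r pq pr qr
      with UsesEdge? (Path.verts p) u v | UsesEdge? (Path.verts q) u v | UsesEdge? (Path.verts r) u v
    ... | yes p-uses  | yes q-uses  | _           = pq u v p-uses q-uses
    ... | yes p-uses  | no _        | yes r-uses  = pr u v p-uses r-uses
    ... | yes _       | no q-avoids | no r-avoids = no-disjoint-paths-avoiding-edge q r qr q-avoids r-avoids
    ... | no _        | yes q-uses  | yes r-uses  = qr u v q-uses r-uses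
    ... | no p-avoids | yes _       | no r-avoids = no-disjoint-paths-avoiding-edge p r pr p-avoids r-avoids
    ... | no p-avoids | no q-avoids | _           = no-disjoint-paths-avoiding-edge p q pq p-avoids q-avoids

    disjointPaths≤2 : ∀ k (P : Fin k → Path G u v) → PairwiseEdgeDisjoint G P → k ≤ 2
    disjointPaths≤2 zero                P _        = z≤n
    disjointPaths≤2 (suc zero)          P _        = s≤s z≤n
    disjointPaths≤2 (suc (suc zero))    P _        = s≤s (s≤s z≤n)
    disjointPaths≤2 (suc (suc (suc k))) P disjoint =
      ⊥-elim (no-three-disjoint-paths (P zero) (P (suc zero)) (P (suc (suc zero)))
                (disjoint _ _ λ ()) (disjoint _ _ λ ()) (disjoint _ _ λ ()))

  -- Degrees and edge cuts

  degree-∑ : ∀ a → degree G a ≡ ∑[ b < n ] ⟦ adj a b ⟧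
  degree-∑ a = length-filter-tabulate (adj a) (λ b → b)

  crossing : (Fin n → Bool) → Fin n → Fin n → ℕ
  crossing S a b = ⟦ S a ⟧ * ⟦ adj a b ⟧ * ⟦ not (S b) ⟧

  cutSize : (Fin n → Bool) → ℕ
  cutSize S = ∑[ a < n ] ∑[ b < n ] crossing S a b

  crossing-zero : ∀ S {a b} → (T (S a) → Adj G a b → ¬ T (S b) → ⊥) → crossing S a b ≡ 0
  crossing-zero S {a} {b} never with S a | adj a b | S b
  ... | true  | true  | false = ⊥-elim (never tt tt λ ())
  ... | true  | true  | true  = refl
  ... | true  | false | _     = refl
  ... | false | _     | _     = refl

  crossing-one : ∀ S {a b} → T (S a) → Adj G a b → ¬ T (S b) → crossing S a b ≡ 1
  crossing-one S {a} {b} Sa ab ¬Sb with S a | adj a b | S b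
  ... | true | true | false = refl
  ... | true | true | true  = ⊥-elim (¬Sb tt)

  even-cut : (∀ a → Even G (degree G a)) → ∀ S → 2 ∣ cutSize S
  even-cut even S =
    ∣m+n∣m⇒∣n (subst (2 ∣_) degrees≡ (∑-even _ λ a → ∣n⇒∣m*n ⟦ S a ⟧ (even a)))
              (∑∑-symmetric-even internal internal-sym internal-diag)
    where
    internal : Fin n → Fin n → ℕ
    internal a b = ⟦ S a ⟧ * ⟦ adj a b ⟧ * ⟦ S b ⟧
    internal-sym : ∀ a b → internal a b ≡ internal b a
    internal-sym a b rewrite Graph.sym G a b = *-reverse ⟦ S a ⟧ ⟦ adj b a ⟧ ⟦ S b ⟧
    internal-diag : ∀ a → internal a a ≡ 0
    internal-diag a rewrite irrefl a = cong (_* ⟦ S a ⟧) (*-zeroʳ ⟦ S a ⟧)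
    open ≡-Reasoning
    degrees≡ : ∑[ a < n ] (⟦ S a ⟧ * degree G a) ≡ ∑[ a < n ] ∑[ b < n ] internal a b + cutSize S
    degrees≡ = begin
      ∑[ a < n ] (⟦ S a ⟧ * degree G a)
        ≡⟨ sum-cong-≗ (λ a → trans (cong (⟦ S a ⟧ *_) (degree-∑ a))
                                   (*-distribˡ-sum ⟦ S a ⟧ (λ b → ⟦ adj a b ⟧))) ⟩
      ∑[ a < n ] ∑[ b < n ] (⟦ S a ⟧ * ⟦ adj a b ⟧)
        ≡⟨ sum-cong-≗ (λ a → trans (sum-cong-≗ λ b → split-by (⟦ S a ⟧ * ⟦ adj a b ⟧) (S b))
                                   (∑-distrib-+ (internal a) (crossing S a))) ⟩
      ∑[ a < n ] (∑[ b < n ] internal a b + ∑[ b < n ] crossing S a b)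
        ≡⟨ ∑-distrib-+ (λ a → ∑[ b < n ] internal a b) (λ a → ∑[ b < n ] crossing S a b) ⟩
      ∑[ a < n ] ∑[ b < n ] internal a b + cutSize S ∎

  -- Reachability

  module _ (t : Fin n) where

    reachesIn : ℕ → Fin n → Bool
    reachesIn zero    w = does (w ≟ t)
    reachesIn (suc k) w = reachesIn k w ∨ any (λ x → adj w x ∧ reachesIn k x) (allFin n)

    -- n rounds suffice since a path has at most n vertices (see reaches-complete).
    reaches : Fin n → Bool
    reaches = reachesIn n

    reachesIn-target : ∀ k → T (reachesIn k t)
    reachesIn-target zero    = T-≡ .from (dec-true (t ≟ t) refl)
    reachesIn-target (suc k) = T-∨ .from (inj₁ (reachesIn-target k))

    reachesIn-sound : ∀ k w → T (reachesIn k w) → Path G w t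
    reachesIn-sound zero    w reach with w ≟ t
    ... | yes refl = trivialPath t
    reachesIn-sound (suc k) w reach with T-∨ .to reach
    ... | inj₁ reach′ = reachesIn-sound k w reach′
    ... | inj₂ some with satisfied (any⁻ _ (allFin n) some)
    ...   | x , wx∧reach = Path-cons (proj₁ (T-∧ .to wx∧reach)) (reachesIn-sound k x (proj₂ (T-∧ .to wx∧reach)))

    reachesIn-complete : ∀ k w xs → IsWalk G (w ∷ xs) → last (w ∷ xs) ≡ just t → length xs ≤ k →
                         T (reachesIn k w)
    reachesIn-complete k       w []       _    refl _         = reachesIn-target k
    reachesIn-complete (suc k) w (x ∷ xs) walk end  (s≤s len) =
      T-∨ .from (inj₂ (any⁺ _ (lose (∈-allFin x) (T-∧ .from (walk w x (here refl) ,
        reachesIn-complete k x xs (λ a b ab∈ → walk a b (there ab∈)) end len)))))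

    reaches-target : T (reaches t)
    reaches-target = reachesIn-target n

    reaches-sound : ∀ {w} → T (reaches w) → Path G w t
    reaches-sound = reachesIn-sound n _

    reaches-complete : ∀ {w} → Path G w t → T (reaches w)
    reaches-complete record { verts = w ∷ xs ; start = refl ; end = end ; walk = walk ; unique = unique } =
      reachesIn-complete n w xs walk end (≤-trans (n≤1+n _) (Unique⇒length≤ unique))

    reaches-closed : ∀ {w x} → Adj G w x → T (reaches x) → T (reaches w)
    reaches-closed wx reach = reaches-complete (Path-cons wx (reaches-sound reach))

removeEdge : ∀ {n} → Graph n → Fin n → Fin n → Graph n
removeEdge G u v = record
  { adj    = adj⁻
  ; sym    = λ a b → cong₂ (λ x y → x ∧ not y) (Graph.sym G a b)
                       (does-⇔ (mk⇔ SameEdge-flip SameEdge-flip) (SameEdge? (a , b) (u , v)) (SameEdge? (b , a) (u , v)))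
  ; irrefl = λ a → cong (_∧ _) (Graph.irrefl G a)
  }
  where
  adj⁻ : Fin _ → Fin _ → Bool
  adj⁻ a b = Graph.adj G a b ∧ not (does (SameEdge? (a , b) (u , v)))

module _ {n : ℕ} (G : Graph n) (u v : Fin n) where

  removeEdge-⊆ : ∀ {a b} → Adj (removeEdge G u v) a b → Adj G a b
  removeEdge-⊆ ab = proj₁ (T-∧ .to ab)

  removeEdge-removes : ¬ Adj (removeEdge G u v) u v
  removeEdge-removes uv rewrite dec-true (SameEdge? (u , v) (u , v)) (inj₁ (refl , refl)) = proj₂ (T-∧ .to uv)

  removeEdge-only : ∀ {a b} → Adj G a b → ¬ Adj (removeEdge G u v) a b → SameEdge (a , b) (u , v)
  removeEdge-only {a} {b} ab ¬ab⁻ = T-does⁻ (SameEdge? (a , b) (u , v)) (T-∧-not⁻ ab ¬ab⁻)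
    where
    T-∧-not⁻ : ∀ {x y} → T x → ¬ T (x ∧ not y) → T y
    T-∧-not⁻ {true} {true}  _ _    = tt
    T-∧-not⁻ {true} {false} _ ¬x∧y = ¬x∧y tt
    T-does⁻ : ∀ {P : Set} (P? : Dec P) → T (does P?) → P
    T-does⁻ (yes p) _ = p

-- Defs.steps is parametrised by a graph that it never inspects.
steps-graph-irrelevant : ∀ {n} (G H : Graph n) xs → steps G xs ≡ steps H xs
steps-graph-irrelevant G H []           = refl
steps-graph-irrelevant G H (x ∷ [])     = refl
steps-graph-irrelevant G H (x ∷ y ∷ xs) = cong ((x , y) ∷_) (steps-graph-irrelevant G H (y ∷ xs))

Path-mono : ∀ {n} {G H : Graph n} {u v} → (∀ {a b} → Adj H a b → Adj G a b) → Path H u v → Path G u v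
Path-mono {G = G} {H} H⊆G p = record
  { verts  = Path.verts p
  ; start  = Path.start p
  ; end    = Path.end p
  ; walk   = λ a b ab∈ → H⊆G (Path.walk p a b (subst (_ ∈_) (steps-graph-irrelevant G H (Path.verts p)) ab∈))
  ; unique = Path.unique p
  }

-- Even graphs have no bridges

module _ {n : ℕ} {G : Graph n} (even : ∀ a → Even G (degree G a)) {u v : Fin n} (uv : Adj G u v) where

  private
    G⁻ = removeEdge G u v
    S  = reaches G⁻ v

  crossing-edge : ∀ {a b} → ¬ T (S u) → T (S a) → Adj G a b → ¬ T (S b) → a ≡ v × b ≡ u
  crossing-edge ¬Su Sa ab ¬Sb
    with removeEdge-only G u v ab (λ ab⁻ → ¬Sb (reaches-closed G⁻ v (Adj-sym G⁻ ab⁻) Sa))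
  ... | inj₁ (refl , _)    = ⊥-elim (¬Su Sa)
  ... | inj₂ (a≡v , b≡u)   = a≡v , b≡u

  cutSize≡1 : ¬ T (S u) → cutSize G S ≡ 1
  cutSize≡1 ¬Su = begin
    cutSize G S
      ≡⟨ ∑-supported (λ a → ∑[ b < n ] crossing G S a b) v (λ a a≢v → ∑-zero (crossing G S a) λ b →
           crossing-zero G S λ Sa ab ¬Sb → a≢v (proj₁ (crossing-edge ¬Su Sa ab ¬Sb))) ⟩
    ∑[ b < n ] crossing G S v b
      ≡⟨ ∑-supported (crossing G S v) u (λ b b≢u →
           crossing-zero G S λ Sv vb ¬Sb → b≢u (proj₂ (crossing-edge ¬Su Sv vb ¬Sb))) ⟩
    crossing G S v u
      ≡⟨ crossing-one G S (reaches-target G⁻ v) (Adj-sym G uv) ¬Su ⟩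
    1 ∎
    where open ≡-Reasoning

  u-reaches-v : T (S u)
  u-reaches-v with S u in Su≡
  ... | true  = tt
  ... | false = ⊥-elim (2∤1 (subst (2 ∣_) (cutSize≡1 (subst T Su≡)) (even-cut G even S)))
    where
    2∤1 : ¬ 2 ∣ 1
    2∤1 2∣1 with ∣⇒≤ 2∣1
    ... | s≤s ()

  evenDegree⇒avoidingPath : Σ[ p ∈ Path G u v ] ¬ UsesEdge G (Path.verts p) u v
  evenDegree⇒avoidingPath = Path-mono (removeEdge-⊆ G u v) p , avoids
    where
    p : Path G⁻ u v
    p = reaches-sound G⁻ v u-reaches-v
    steps≡ : steps G (Path.verts p) ≡ steps G⁻ (Path.verts p)
    steps≡ = steps-graph-irrelevant G G⁻ (Path.verts p)
    avoids : ¬ UsesEdge G (Path.verts p) u v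
    avoids (inj₁ uv∈) = removeEdge-removes G u v (Path.walk p u v (subst (_ ∈_) steps≡ uv∈))
    avoids (inj₂ vu∈) = removeEdge-removes G u v (Adj-sym G⁻ (Path.walk p v u (subst (_ ∈_) steps≡ vu∈)))

theorem5 : (n : ℕ) (G : Graph n) → InEps0 G →
    ∀ (u v : Fin n) → Adj G u v → MaxEdgeDisjointPaths G u v 2
theorem5 n G ((_ , _ , even) , cycle-length) u v uv =
  (paths , disjoint) , disjointPaths≤2 G cycle-length uv
  where
  p : Path G u v
  p = proj₁ (evenDegree⇒avoidingPath even uv)
  p-avoids : ¬ UsesEdge G (Path.verts p) u v
  p-avoids = proj₂ (evenDegree⇒avoidingPath even uv)
  edge-p : EdgeDisjoint G (edgePath G uv) p
  edge-p = EdgeDisjoint-sym G p (edgePath G uv) (avoids⇒EdgeDisjoint-edgePath G uv p p-avoids)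
  paths : Fin 2 → Path G u v
  paths zero       = edgePath G uv
  paths (suc zero) = p
  disjoint : PairwiseEdgeDisjoint G paths
  disjoint zero       zero       0≢0 = ⊥-elim (0≢0 refl)
  disjoint zero       (suc zero) _   = edge-p
  disjoint (suc zero) zero       _   = EdgeDisjoint-sym G (edgePath G uv) p edge-p
  disjoint (suc zero) (suc zero) 1≢1 = ⊥-elim (1≢1 refl)
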